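{- Let $G$ be a finite simple graph without isolated vertices with $\delta(G)=1$, let $x$ be a vertex of degree $1$ and $y$ its unique neighbor. Let $\Phi$ be a trc-partition of $G$ of cardinality $C_{tr}(G)$, and let $X,Y\in\Phi$ with $x\in X$ and $y\in Y$ (possibly $X=Y$). Then for any two sets $A,B\in\Phi$ that form a total restrained coalition, $A\in\{X,Y\}$ or $B\in\{X,Y\}$.
   Context: A set $S\subseteq V$ is a total restrained dominating set (TRD-set) of $G=(V,E)$ if every vertex of $V\setminus S$ is adjacent to at least one vertex of $S$ and to at least one other vertex of $V\setminus S$, and every vertex of $S$ is adjacent to at least one other vertex of $S$. Two disjoint sets $X,Y\subseteq V$ form a total restrained coalition if neither is a TRD-set but $X\cup Y$ is a TRD-set. A trc-partition of $G$ is a partition $\Phi$ of $V$ such that no member of $\Phi$ is a TRD-set and each member forms a total restrained coalition with some other member of $\Phi$. $C_{tr}(G)$ is the maximum cardinality of a trc-partition of $G$. -}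

module Defs where

open import Data.Nat using (ℕ; _≤_)
open import Data.Fin using (Fin)
open import Data.Product using (Σ; ∃; ∃-syntax; _×_)
open import Data.Sum using (_⊎_)
open import Data.Empty using (⊥)
open import Relation.Nullary using (¬_)
open import Relation.Binary.PropositionalEquality using (_≡_; _≢_)
open import Function.Definitions using (Surjective)

record Graph (n : ℕ) : Set₁ where
  field
    Adj   : Fin n → Fin n → Set
    sym   : ∀ {u v} → Adj u v → Adj v u
    irrefl : ∀ {v} → ¬ Adj v v

open Graph public

VSet : ℕ → Set₁
VSet n = Fin n → Set

_∪_ : ∀ {n} → VSet n → VSet n → VSet n
(X ∪ Y) v = X v ⊎ Y v

Disjoint : ∀ {n} → VSet n → VSet n → Set
Disjoint X Y = ∀ v → X v → Y v → ⊥

NoIsolated : ∀ {n} → Graph n → Set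
NoIsolated G = ∀ v → ∃[ w ] Adj G v w

UniqueNeighbour : ∀ {n} → Graph n → Fin n → Fin n → Set
UniqueNeighbour G x y = Adj G x y × (∀ z → Adj G x z → z ≡ y)

-- total restrained dominating set (irreflexivity makes "other" automatic)
IsTRD : ∀ {n} → Graph n → VSet n → Set
IsTRD G S =
  (∀ v → ¬ S v → (∃[ u ] (S u × Adj G v u)) × (∃[ w ] (¬ S w × Adj G v w)))
  × (∀ v → S v → ∃[ u ] (S u × Adj G v u))

TRCoalition : ∀ {n} → Graph n → VSet n → VSet n → Set
TRCoalition G X Y = Disjoint X Y × ¬ IsTRD G X × ¬ IsTRD G Y × IsTRD G (X ∪ Y)

-- a partition of V into k (nonempty) members, given by a surjective
-- membership map f; member i is the class f⁻¹(i)
Class : ∀ {n k} → (Fin n → Fin k) → Fin k → VSet n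
Class f i v = f v ≡ i

IsTRCPartition : ∀ {n k} → Graph n → (Fin n → Fin k) → Set
IsTRCPartition G f =
  Surjective _≡_ _≡_ f
  × (∀ i → ¬ IsTRD G (Class f i))
  × (∀ i → ∃[ j ] (j ≢ i × TRCoalition G (Class f i) (Class f j)))

IsMaxTRCPartition : ∀ {n k} → Graph n → (Fin n → Fin k) → Set
IsMaxTRCPartition {n} {k} G f =
  IsTRCPartition G f × (∀ k' (g : Fin n → Fin k') → IsTRCPartition G g → k' ≤ k)

module Submission where

open import Defs
open import Data.Fin using (Fin; _≟_)
open import Data.Product using (_,_)
open import Data.Sum using (_⊎_; inj₁; inj₂)
open import Relation.Nullary using (Dec; yes; no)
open import Relation.Nullary.Decidable using (_⊎-dec_)
open import Relation.Binary.PropositionalEquality using (_≡_; _≢_; subst) renaming (sym to ≡-sym)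

pendant-or-neighbour-∈-TRD : ∀ {n} (G : Graph n) {x y : Fin n} → UniqueNeighbour G x y
  → (S : VSet n) → Dec (S x) → IsTRD G S → S x ⊎ S y
pendant-or-neighbour-∈-TRD G _            S (yes x∈S) _ = inj₁ x∈S
pendant-or-neighbour-∈-TRD G (_ , unique) S (no x∉S) (dominates , _)
  with dominates _ x∉S
... | (u , u∈S , x~u) , _ = inj₂ (subst S (unique u x~u) u∈S)

lemma2p10 : ∀ {n k} (G : Graph n) → NoIsolated G
    → (x y : Fin n) → UniqueNeighbour G x y
    → (f : Fin n → Fin k) → IsMaxTRCPartition G f
    → (a b : Fin k) → a ≢ b → TRCoalition G (Class f a) (Class f b)
    → (a ≡ f x ⊎ a ≡ f y) ⊎ (b ≡ f x ⊎ b ≡ f y)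
lemma2p10 G _ x y pendant f _ a b _ (_ , _ , _ , a∪b-TRD)
  with pendant-or-neighbour-∈-TRD G pendant (Class f a ∪ Class f b)
         ((f x ≟ a) ⊎-dec (f x ≟ b)) a∪b-TRD
... | inj₁ (inj₁ fx≡a) = inj₁ (inj₁ (≡-sym fx≡a))
... | inj₁ (inj₂ fx≡b) = inj₂ (inj₁ (≡-sym fx≡b))
... | inj₂ (inj₁ fy≡a) = inj₁ (inj₂ (≡-sym fy≡a))
... | inj₂ (inj₂ fy≡b) = inj₂ (inj₂ (≡-sym fy≡b))
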